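{- Let $\mathbf{C}$ be a Cartesian closed differential category that models the Taylor expansion, and let $\mathscr{U}=(U,\mathcal{A},\lambda)$ be a linear reflexive object in $\mathbf{C}$. Then for every differential $\lambda$-term $S$ and every sequence $\vec x$ adequate for $S$, $[\![S]\!]_{\vec x}=[\![S^*]\!]_{\vec x}$.
   Context: Cartesian closed differential category: a category with commutative-monoid homsets $(+,0)$ satisfying $(g+h)\circ f=g\circ f+h\circ f$, $0\circ f=0$, with finite products whose projections are additive and pairings of additive maps additive, with an operator $D$ sending $f:A\to B$ to $D(f):A\times A\to B$ satisfying (D1) $D(f+g)=D(f)+D(g)$, $D(0)=0$; (D2) $D(f)\circ\langle h+k,v\rangle=D(f)\circ\langle h,v\rangle+D(f)\circ\langle k,v\rangle$, $D(f)\circ\langle0,v\rangle=0$; (D3) $D(\mathrm{Id})=\pi_1$, $D(\pi_1)=\pi_1\circ\pi_1$, $D(\pi_2)=\pi_2\circ\pi_1$; (D4) $D\langle f,g\rangle=\langle Df,Dg\rangle$; (D5) $D(f\circ g)=D(f)\circ\langle D(g),g\circ\pi_2\rangle$; (D6) $D(D(f))\circ\langle\langle g,0\rangle,\langle h,k\rangle\rangle=D(f)\circ\langle g,k\rangle$; (D7) $D(D(f))\circ\langle\langle0,h\rangle,\langle g,k\rangle\rangle=D(D(f))\circ\langle\langle0,g\rangle,\langle h,k\rangle\rangle$; Cartesian closed with $\Lambda(f+g)=\Lambda f+\Lambda g$, $\Lambda(0)=0$, $D(\Lambda f)=\Lambda(D(f)\circ\langle\pi_1\times0_A,\pi_2\times\mathrm{Id}_A\rangle)$.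 $\Lambda^-(h)=\mathrm{ev}\circ(h\times\mathrm{Id})$; $f$ linear iff $D(f)=f\circ\pi_1$; $f\star g=D(f)\circ\langle\langle0_C,g\circ\pi_1\rangle,\mathrm{Id}_{C\times A}\rangle$ for $f:C\times A\to B$, $g:C\to A$. Linear reflexive object: linear $\mathcal{A}:U\to[U\Rightarrow U]$, $\lambda:[U\Rightarrow U]\to U$ with $\mathcal{A}\circ\lambda=\mathrm{Id}$. $\mathbf{C}$ models the Taylor expansion if it has countable sums (every countable family $f_i:A\to B$ has a sum $\sum_i f_i\in\mathbf{C}(A,B)$), the sum is idempotent, and for all $f:C\to[A\Rightarrow B]$, $g:C\to A$: $\mathrm{ev}\circ\langle f,g\rangle=\sum_{k\in\mathbb{N}}((\cdots(\Lambda^-(f)\star g)\cdots)\star g)\circ\langle\mathrm{Id}_C,0\rangle$ with $k$ occurrences of $\star g$. Syntax: differential $\lambda$-terms $S::=0\mid s\mid s+S$, simple terms $s,t::=x\mid\lambda x.s\mid sT\mid\mathsf{D}s\cdot t$, modulo $\alpha$, AC of $+$ with unit $0$ and permutation of arguments of $\mathsf{D}^ns\cdot(t_1,\dots,t_n)$ ($\mathsf{D}^1s\cdot t=\mathsf{D}s\cdot t$, $\mathsf{D}^{n+1}s\cdot(t,t_1..t_n)=\mathsf{D}^n(\mathsf{D}s\cdot t)\cdot(t_1..t_n)$, $\mathsf{D}^0s\cdot()=s$); abbreviations $\lambda x.\sum s_i=\sum\lambda x.s_i$, $(\sum s_i)T=\sum s_iT$, $\mathsf{D}(\sum s_i)\cdot(\sum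 t_j)=\sum\mathsf{D}s_i\cdot t_j$. The Taylor expansion $S^*$ (a term possibly containing countable, idempotent sums) is: $x^*=x$; $(\lambda x.s)^*=\lambda x.s^*$; $(\mathsf{D}^ks\cdot(t_1..t_k))^*=\mathsf{D}^ks^*\cdot(t_1^*..t_k^*)$; $(sT)^*=\sum_{k\in\mathbb{N}}(\mathsf{D}^ks^*\cdot(T^*,\dots,T^*))0$; $(s+T)^*=s^*+T^*$. Interpretation $[\![S]\!]_{\vec x}:U^{\vec x}\to U$ for $\vec x$ a sequence of distinct variables containing $\mathrm{FV}(S)$, $U^{x_1..x_n}=U^{x_1..x_{n-1}}\times U$: $[\![x_i]\!]=\pi_i$; $[\![sT]\!]=\mathrm{ev}\circ\langle\mathcal{A}\circ[\![s]\!],[\![T]\!]\rangle$; $[\![\lambda z.s]\!]_{\vec x}=\lambda\circ\Lambda([\![s]\!]_{\vec x,z})$; $[\![\mathsf{D}^1s\cdot t]\!]=\lambda\circ\Lambda(\Lambda^-(\mathcal{A}\circ[\![s]\!])\star[\![t]\!])$; $[\![\mathsf{D}^{n+1}s\cdot(t_1..t_{n+1})]\!]=\lambda\circ\Lambda(\Lambda^-(\mathcal{A}\circ[\![\mathsf{D}^ns\cdot(t_1..t_n)]\!])\star[\![t_{n+1}]\!])$; $[\![0]\!]=0$; $[\![s+S]\!]=[\![s]\!]+[\![S]\!]$; extended to countable sums by $[\![\sum_{i\in I}s_i]\!]=\sum_{i\in I}[\![s_i]\!]$. -}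

module Defs where

open import Level using (Level; _⊔_) renaming (suc to lsuc)
open import Data.Nat using (ℕ; zero; suc; _≤_)
open import Data.Fin using (Fin; zero; suc)
open import Data.Product using (Σ; ∃; _,_; proj₁; proj₂) renaming (_×_ to _∧_)
open import Data.List using (List; []; _∷_; map; _++_; concatMap)
open import Function using (Surjective)
open import Relation.Binary.PropositionalEquality using (_≡_)
open import Relation.Binary using (Rel; IsEquivalence)

record LeftAdditiveCartesian (o ℓ e : Level) : Set (lsuc (o ⊔ ℓ ⊔ e)) where
  infixr 9 _∘_
  infixl 6 _+_
  infix  4 _≈_
  infixr 7 _×_
  field
    Obj   : Set o
    Hom   : Obj → Obj → Set ℓ
    _≈_   : ∀ {A B} → Rel (Hom A B) e
    ≈-isEquivalence : ∀ {A B} → IsEquivalence (_≈_ {A} {B})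
    id    : ∀ {A} → Hom A A
    _∘_   : ∀ {A B C} → Hom B C → Hom A B → Hom A C
    assoc : ∀ {A B C D} {f : Hom A B} {g : Hom B C} {h : Hom C D} →
            (h ∘ g) ∘ f ≈ h ∘ (g ∘ f)
    identityˡ : ∀ {A B} {f : Hom A B} → id ∘ f ≈ f
    identityʳ : ∀ {A B} {f : Hom A B} → f ∘ id ≈ f
    ∘-resp-≈  : ∀ {A B C} {f h : Hom B C} {g i : Hom A B} →
                f ≈ h → g ≈ i → f ∘ g ≈ h ∘ i
    _+_   : ∀ {A B} → Hom A B → Hom A B → Hom A B
    0h    : ∀ {A B} → Hom A B
    +-assoc     : ∀ {A B} {f g h : Hom A B} → (f + g) + h ≈ f + (g + h)
    +-comm      : ∀ {A B} {f g : Hom A B} → f + g ≈ g + f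
    +-identityˡ : ∀ {A B} {f : Hom A B} → 0h + f ≈ f
    +-resp-≈    : ∀ {A B} {f f′ g g′ : Hom A B} → f ≈ f′ → g ≈ g′ → f + g ≈ f′ + g′
    +-∘ : ∀ {A B C} {g h : Hom B C} {f : Hom A B} → (g + h) ∘ f ≈ g ∘ f + h ∘ f
    0-∘ : ∀ {A B C} {f : Hom A B} → 0h {B} {C} ∘ f ≈ 0h
    ⊤        : Obj
    !        : ∀ {A} → Hom A ⊤
    !-unique : ∀ {A} (f : Hom A ⊤) → f ≈ !
    _×_      : Obj → Obj → Obj
    π₁       : ∀ {A B} → Hom (A × B) A
    π₂       : ∀ {A B} → Hom (A × B) B
    ⟨_,_⟩    : ∀ {A B C} → Hom C A → Hom C B → Hom C (A × B)
    project₁ : ∀ {A B C} {f : Hom C A} {g : Hom C B} → π₁ ∘ ⟨ f , g ⟩ ≈ f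
    project₂ : ∀ {A B C} {f : Hom C A} {g : Hom C B} → π₂ ∘ ⟨ f , g ⟩ ≈ g
    ⟨⟩-unique : ∀ {A B C} {f : Hom C A} {g : Hom C B} {h : Hom C (A × B)} →
                π₁ ∘ h ≈ f → π₂ ∘ h ≈ g → ⟨ f , g ⟩ ≈ h

  infixr 8 _×ₕ_
  _×ₕ_ : ∀ {A B C D} → Hom A B → Hom C D → Hom (A × C) (B × D)
  f ×ₕ g = ⟨ f ∘ π₁ , g ∘ π₂ ⟩

  Additive : ∀ {A B} → Hom A B → Set (o ⊔ ℓ ⊔ e)
  Additive {A} f = (∀ {C} (g h : Hom C A) → f ∘ (g + h) ≈ f ∘ g + f ∘ h)
                 ∧ (∀ {C} → f ∘ 0h {C} ≈ 0h)

record CartesianClosedDifferential (o ℓ e : Level) : Set (lsuc (o ⊔ ℓ ⊔ e)) where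
  field
    leftAdditiveCartesian : LeftAdditiveCartesian o ℓ e
  open LeftAdditiveCartesian leftAdditiveCartesian public
  infixr 5 _⇒_
  field
    π₁-additive : ∀ {A B} → Additive (π₁ {A} {B})
    π₂-additive : ∀ {A B} → Additive (π₂ {A} {B})
    ⟨⟩-additive : ∀ {A B C} {f : Hom C A} {g : Hom C B} →
                  Additive f → Additive g → Additive ⟨ f , g ⟩
    D : ∀ {A B} → Hom A B → Hom (A × A) B
    D-resp-≈ : ∀ {A B} {f g : Hom A B} → f ≈ g → D f ≈ D g
    D1-+ : ∀ {A B} {f g : Hom A B} → D (f + g) ≈ D f + D g
    D1-0 : ∀ {A B} → D (0h {A} {B}) ≈ 0h
    D2-+ : ∀ {A B C} {f : Hom A B} {h k v : Hom C A} →
           D f ∘ ⟨ h + k , v ⟩ ≈ D f ∘ ⟨ h , v ⟩ + D f ∘ ⟨ k , v ⟩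
    D2-0 : ∀ {A B C} {f : Hom A B} {v : Hom C A} → D f ∘ ⟨ 0h , v ⟩ ≈ 0h
    D3-id : ∀ {A} → D (id {A}) ≈ π₁
    D3-π₁ : ∀ {A B} → D (π₁ {A} {B}) ≈ π₁ ∘ π₁
    D3-π₂ : ∀ {A B} → D (π₂ {A} {B}) ≈ π₂ ∘ π₁
    D4 : ∀ {A B C} {f : Hom A B} {g : Hom A C} → D ⟨ f , g ⟩ ≈ ⟨ D f , D g ⟩
    D5 : ∀ {A B C} {f : Hom B C} {g : Hom A B} →
         D (f ∘ g) ≈ D f ∘ ⟨ D g , g ∘ π₂ ⟩
    D6 : ∀ {A B C} {f : Hom A B} {g h k : Hom C A} →
         D (D f) ∘ ⟨ ⟨ g , 0h ⟩ , ⟨ h , k ⟩ ⟩ ≈ D f ∘ ⟨ g , k ⟩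
    D7 : ∀ {A B C} {f : Hom A B} {g h k : Hom C A} →
         D (D f) ∘ ⟨ ⟨ 0h , h ⟩ , ⟨ g , k ⟩ ⟩ ≈ D (D f) ∘ ⟨ ⟨ 0h , g ⟩ , ⟨ h , k ⟩ ⟩
    _⇒_ : Obj → Obj → Obj
    ev  : ∀ {A B} → Hom ((A ⇒ B) × A) B
    Λ   : ∀ {A B C} → Hom (C × A) B → Hom C (A ⇒ B)
    Λ-β : ∀ {A B C} {f : Hom (C × A) B} → ev ∘ (Λ f ×ₕ id) ≈ f
    Λ-unique : ∀ {A B C} {f : Hom (C × A) B} {h : Hom C (A ⇒ B)} →
               ev ∘ (h ×ₕ id) ≈ f → h ≈ Λ f
    Λ-+ : ∀ {A B C} {f g : Hom (C × A) B} → Λ (f + g) ≈ Λ f + Λ g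
    Λ-0 : ∀ {A B C} → Λ (0h {C × A} {B}) ≈ 0h
    D-Λ : ∀ {A B C} {f : Hom (C × A) B} →
          D (Λ f) ≈ Λ (D f ∘ ⟨ π₁ ×ₕ 0h {A} {A} , π₂ ×ₕ id {A} ⟩)

  Λ⁻ : ∀ {A B C} → Hom C (A ⇒ B) → Hom (C × A) B
  Λ⁻ h = ev ∘ (h ×ₕ id)

  _⋆_ : ∀ {A B C} → Hom (C × A) B → Hom C A → Hom (C × A) B
  f ⋆ g = D f ∘ ⟨ ⟨ 0h , g ∘ π₁ ⟩ , id ⟩

  Linear : ∀ {A B} → Hom A B → Set e
  Linear f = D f ≈ f ∘ π₁

finSum : ∀ {o ℓ e} (C : LeftAdditiveCartesian o ℓ e) →
         let open LeftAdditiveCartesian C in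
         ∀ {A B} → ℕ → (ℕ → Hom A B) → Hom A B
finSum C zero    f = LeftAdditiveCartesian.0h C
finSum C (suc k) f = LeftAdditiveCartesian._+_ C (finSum C k f) (f k)

iter : ∀ {a} {X : Set a} → ℕ → (X → X) → X → X
iter zero    h x = x
iter (suc k) h x = h (iter k h x)

record TaylorModel (o ℓ e : Level) : Set (lsuc (o ⊔ ℓ ⊔ e)) where
  field
    ccdc : CartesianClosedDifferential o ℓ e
  open CartesianClosedDifferential ccdc public
  field
    ∑ : ∀ {A B} → (ℕ → Hom A B) → Hom A B
    ∑-finite : ∀ {A B} (f : ℕ → Hom A B) (k : ℕ) →
               (∀ m → k ≤ m → f m ≈ 0h) → ∑ f ≈ finSum leftAdditiveCartesian k f
    -- idempotency: the sum only depends on the set of summands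
    ∑-idem : ∀ {A B} (f g : ℕ → Hom A B) →
             (∀ n → ∃ λ m → f n ≈ g m) → (∀ m → ∃ λ n → g m ≈ f n) →
             ∑ f ≈ ∑ g
    ∑-assoc : ∀ {A B} (f : ℕ → ℕ → Hom A B) (p : ℕ → ℕ) (q : ℕ → ℕ) →
              (∀ i j → ∃ λ k → (p k ≡ i) ∧ (q k ≡ j)) →
              ∑ (λ i → ∑ (λ j → f i j)) ≈ ∑ (λ k → f (p k) (q k))
    ∑-∘  : ∀ {A B C} (f : ℕ → Hom B C) (g : Hom A B) →
           ∑ f ∘ g ≈ ∑ (λ i → f i ∘ g)
    π₁-∑ : ∀ {A B C} (f : ℕ → Hom C (A × B)) → π₁ ∘ ∑ f ≈ ∑ (λ i → π₁ ∘ f i)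
    π₂-∑ : ∀ {A B C} (f : ℕ → Hom C (A × B)) → π₂ ∘ ∑ f ≈ ∑ (λ i → π₂ ∘ f i)
    ⟨⟩-∑ : ∀ {A B C} {f : Hom C A} {g : Hom C B} →
           (∀ {X} (h : ℕ → Hom X C) → f ∘ ∑ h ≈ ∑ (λ i → f ∘ h i)) →
           (∀ {X} (h : ℕ → Hom X C) → g ∘ ∑ h ≈ ∑ (λ i → g ∘ h i)) →
           (∀ {X} (h : ℕ → Hom X C) → ⟨ f , g ⟩ ∘ ∑ h ≈ ∑ (λ i → ⟨ f , g ⟩ ∘ h i))
    D1-∑ : ∀ {A B} (f : ℕ → Hom A B) → D (∑ f) ≈ ∑ (λ i → D (f i))
    D2-∑ : ∀ {A B C} (f : Hom A B) (h : ℕ → Hom C A) (v : Hom C A) →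
           D f ∘ ⟨ ∑ h , v ⟩ ≈ ∑ (λ i → D f ∘ ⟨ h i , v ⟩)
    Λ-∑  : ∀ {A B C} (f : ℕ → Hom (C × A) B) → Λ (∑ f) ≈ ∑ (λ i → Λ (f i))
    taylor : ∀ {A B C} (f : Hom C (A ⇒ B)) (g : Hom C A) →
             ev ∘ ⟨ f , g ⟩ ≈ ∑ (λ k → iter k (λ h → h ⋆ g) (Λ⁻ f) ∘ ⟨ id , 0h ⟩)

record LinearReflexive {o ℓ e} (C : CartesianClosedDifferential o ℓ e) : Set (o ⊔ ℓ ⊔ e) where
  open CartesianClosedDifferential C
  field
    U : Obj
    𝒜 : Hom U (U ⇒ U)
    lam : Hom (U ⇒ U) U
    𝒜-linear : Linear 𝒜
    lam-linear : Linear lam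
    retract : 𝒜 ∘ lam ≈ id

-- Part 2. Differential λ-terms (de Bruijn indices; n = number of free
-- variables in scope, index zero = most recently bound variable)

mutual
  data Simple (n : ℕ) : Set where
    var : Fin n → Simple n
    lam : Simple (suc n) → Simple n
    app : Simple n → Term n → Simple n
    D·  : Simple n → Simple n → Simple n

  -- differential λ-terms  S ::= 0 | s + S
  Term : ℕ → Set
  Term n = List (Simple n)

-- a countable sum of simple terms, given as ℕ-indexed family of finite sums;
-- it denotes  Σ_{i∈ℕ} F i
Fam : ℕ → Set
Fam n = ℕ → Term n

-- an enumeration of ℕ × ℕ (Cantor diagonal order), used to flatten double sums
nextPair : ℕ ∧ ℕ → ℕ ∧ ℕ
nextPair (a , zero)  = (zero , suc a)
nextPair (a , suc b) = (suc a , b)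

unpair : ℕ → ℕ ∧ ℕ
unpair zero    = (zero , zero)
unpair (suc k) = nextPair (unpair k)

single : ∀ {n} → Simple n → Fam n
single s zero    = s ∷ []
single s (suc _) = []

-- λx.Σ sᵢ = Σ λx.sᵢ  and  (Σ sᵢ) 0 = Σ (sᵢ 0)  etc.
mapFam : ∀ {m n} → (Simple m → Simple n) → Fam m → Fam n
mapFam h F i = map h (F i)

-- Σᵢ sᵢ ⊙ Σⱼ tⱼ = Σ_{i,j} sᵢ ⊙ tⱼ
combine : ∀ {n} → (Simple n → Simple n → Simple n) → Fam n → Fam n → Fam n
combine h F G k = concatMap (λ s → map (h s) (G (proj₂ (unpair k)))) (F (proj₁ (unpair k)))

plusFam : ∀ {n} → Fam n → Fam n → Fam n
plusFam F G i = F i ++ G i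

bigSum : ∀ {n} → (ℕ → Fam n) → Fam n
bigSum F m = F (proj₁ (unpair m)) (proj₂ (unpair m))

zeroFam : ∀ {n} → Fam n
zeroFam _ = []

Dpow : ∀ {n} → ℕ → Fam n → Fam n → Fam n
Dpow zero    S T = S
Dpow (suc k) S T = combine D· (Dpow k S T) T

mutual
  _*ˢ : ∀ {n} → Simple n → Fam n
  var x *ˢ   = single (var x)
  lam s *ˢ   = mapFam lam (s *ˢ)
  D· s t *ˢ  = combine D· (s *ˢ) (t *ˢ)
  app s T *ˢ = bigSum (λ k → mapFam (λ u → app u []) (Dpow k (s *ˢ) (T *)))

  _* : ∀ {n} → Term n → Fam n
  [] *      = zeroFam
  (s ∷ S) * = plusFam (s *ˢ) (S *)

module Interpretation {o ℓ e} (M : TaylorModel o ℓ e)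
                      (R : LinearReflexive (TaylorModel.ccdc M)) where
  open TaylorModel M
  open LinearReflexive R

  U^ : ℕ → Obj
  U^ zero    = ⊤
  U^ (suc n) = U^ n × U

  proj : ∀ {n} → Fin n → Hom (U^ n) U
  proj zero    = π₂
  proj (suc i) = proj i ∘ π₁

  mutual
    ⟦_⟧ˢ : ∀ {n} → Simple n → Hom (U^ n) U
    ⟦ var x ⟧ˢ   = proj x
    ⟦ lam s ⟧ˢ   = LinearReflexive.lam R ∘ Λ ⟦ s ⟧ˢ
    ⟦ app s T ⟧ˢ = ev ∘ ⟨ 𝒜 ∘ ⟦ s ⟧ˢ , ⟦ T ⟧ ⟩
    ⟦ D· s t ⟧ˢ  = LinearReflexive.lam R ∘ Λ (Λ⁻ (𝒜 ∘ ⟦ s ⟧ˢ) ⋆ ⟦ t ⟧ˢ)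

    ⟦_⟧ : ∀ {n} → Term n → Hom (U^ n) U
    ⟦ [] ⟧    = 0h
    ⟦ s ∷ S ⟧ = ⟦ s ⟧ˢ + ⟦ S ⟧

  ⟦_⟧∞ : ∀ {n} → Fam n → Hom (U^ n) U
  ⟦ F ⟧∞ = ∑ (λ i → ⟦ F i ⟧)

-- The Taylor axiom rewrites an application ev ∘ ⟨ 𝒜 ∘ a , b ⟩ as the countable sum over k of
-- the k-th iterated linear substitution of b into a, applied to 0; since 𝒜 ∘ lam = id, that
-- iterate is exactly the interpretation of D^k a · (b, …, b) applied to 0.  All other
-- constructs of the expansion merely distribute over countable sums, and every operation
-- used by the interpretation (linear postcomposition, precomposition, Λ, Λ⁻, D and ⋆ in
-- either argument) preserves countable sums.
module Submission where

open import Defs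
open import Data.Nat using (ℕ; zero; suc; _≤_; s≤s)
open import Data.Nat.Properties using (+-suc; +-identityʳ; suc-injective)
open import Data.Product using (∃; _,_; proj₁; proj₂) renaming (_×_ to _∧_)
open import Data.List using ([]; _∷_; map; _++_; concatMap)
open import Function using (flip)
open import Level using (_⊔_)
open import Relation.Binary.Bundles using (Setoid)
open import Relation.Binary.PropositionalEquality as ≡ using (_≡_)
import Relation.Binary.Reasoning.Setoid as SetoidReasoning

-- Local, so that ℕ's _+_ does not clash with the sum of morphisms opened below.
module _ where
  open import Data.Nat using (_+_)

  unpair-surjective-on-diagonal : ∀ d i j → i + j ≡ d → ∃ λ k → unpair k ≡ (i , j)
  unpair-surjective-on-diagonal d       (suc i) j       eq
    with k , p ← unpair-surjective-on-diagonal d i (suc j) (≡.trans (+-suc i j) eq)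
    = suc k , ≡.cong nextPair p
  unpair-surjective-on-diagonal d       zero    zero    _  = zero , ≡.refl
  unpair-surjective-on-diagonal (suc d) zero    (suc j) eq
    with k , p ← unpair-surjective-on-diagonal d j zero
                   (≡.trans (+-identityʳ j) (suc-injective eq))
    = suc k , ≡.cong nextPair p

  unpair-surjective : ∀ i j → ∃ λ k → unpair k ≡ (i , j)
  unpair-surjective i j = unpair-surjective-on-diagonal (i + j) i j ≡.refl

unpair-covers : ∀ i j → ∃ λ k → (proj₁ (unpair k) ≡ i) ∧ (proj₂ (unpair k) ≡ j)
unpair-covers i j with k , p ← unpair-surjective i j = k , ≡.cong proj₁ p , ≡.cong proj₂ p

unpair-covers-swapped : ∀ j i → ∃ λ k → (proj₂ (unpair k) ≡ j) ∧ (proj₁ (unpair k) ≡ i)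
unpair-covers-swapped j i with k , p , q ← unpair-covers i j = k , q , p

module CountableSums {o ℓ e} (M : TaylorModel o ℓ e) where
  open TaylorModel M

  homSetoid : Obj → Obj → Setoid ℓ e
  homSetoid A B = record { isEquivalence = ≈-isEquivalence {A} {B} }

  module ≈-Reasoning {A B : Obj} = SetoidReasoning (homSetoid A B)
  open module ≈ {A B : Obj} = Setoid (homSetoid A B) using (refl; sym; trans) public

  ∘-congˡ : ∀ {A B C} {f h : Hom B C} {g : Hom A B} → f ≈ h → f ∘ g ≈ h ∘ g
  ∘-congˡ p = ∘-resp-≈ p refl

  ∘-congʳ : ∀ {A B C} {f : Hom B C} {g i : Hom A B} → g ≈ i → f ∘ g ≈ f ∘ i
  ∘-congʳ p = ∘-resp-≈ refl p

  ⟨⟩-cong : ∀ {A B C} {f f′ : Hom C A} {g g′ : Hom C B} →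
            f ≈ f′ → g ≈ g′ → ⟨ f , g ⟩ ≈ ⟨ f′ , g′ ⟩
  ⟨⟩-cong p q = ⟨⟩-unique (trans project₁ (sym p)) (trans project₂ (sym q))

  ⟨⟩-∘ : ∀ {A B C X} {f : Hom C A} {g : Hom C B} {h : Hom X C} →
         ⟨ f , g ⟩ ∘ h ≈ ⟨ f ∘ h , g ∘ h ⟩
  ⟨⟩-∘ = sym (⟨⟩-unique (trans (sym assoc) (∘-congˡ project₁))
                        (trans (sym assoc) (∘-congˡ project₂)))

  +-identityʳ′ : ∀ {A B} {f : Hom A B} → f + 0h ≈ f
  +-identityʳ′ = trans +-comm +-identityˡ

  ∑-cong : ∀ {A B} {f g : ℕ → Hom A B} → (∀ i → f i ≈ g i) → ∑ f ≈ ∑ g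
  ∑-cong {f = f} {g} p = ∑-idem f g (λ n → n , p n) (λ m → m , sym (p m))

  ∑-0h : ∀ {A B} → ∑ (λ _ → 0h {A} {B}) ≈ 0h
  ∑-0h = ∑-finite _ 0 (λ _ _ → refl)

  ∑-flatten : ∀ {A B} (f : ℕ → ℕ → Hom A B) →
              ∑ (λ i → ∑ (f i)) ≈ ∑ (λ k → f (proj₁ (unpair k)) (proj₂ (unpair k)))
  ∑-flatten f = ∑-assoc f _ _ unpair-covers

  ∑-comm : ∀ {A B} (f : ℕ → ℕ → Hom A B) →
           ∑ (λ i → ∑ (f i)) ≈ ∑ (λ j → ∑ (λ i → f i j))
  ∑-comm f = trans (∑-flatten f) (sym (∑-assoc (flip f) _ _ unpair-covers-swapped))

  pairFamily : ∀ {A B} → Hom A B → Hom A B → ℕ → Hom A B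
  pairFamily f g zero          = f
  pairFamily f g (suc zero)    = g
  pairFamily f g (suc (suc _)) = 0h

  ∑-pairFamily : ∀ {A B} (f g : Hom A B) → ∑ (pairFamily f g) ≈ f + g
  ∑-pairFamily f g = trans (∑-finite (pairFamily f g) 2 vanishes) (+-resp-≈ +-identityˡ refl)
    where
    vanishes : ∀ m → 2 ≤ m → pairFamily f g m ≈ 0h
    vanishes (suc (suc m)) _         = refl
    vanishes (suc zero)    (s≤s ())

  ∑-+ : ∀ {A B} (f g : ℕ → Hom A B) → ∑ (λ i → f i + g i) ≈ ∑ f + ∑ g
  ∑-+ f g = begin
    ∑ (λ i → f i + g i)                          ≈⟨ ∑-cong (λ i → ∑-pairFamily (f i) (g i)) ⟨
    ∑ (λ i → ∑ (pairFamily (f i) (g i)))         ≈⟨ ∑-comm (λ i → pairFamily (f i) (g i)) ⟩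
    ∑ (λ j → ∑ (λ i → pairFamily (f i) (g i) j)) ≈⟨ ∑-cong columns ⟩
    ∑ (pairFamily (∑ f) (∑ g))                   ≈⟨ ∑-pairFamily (∑ f) (∑ g) ⟩
    ∑ f + ∑ g                                    ∎
    where
    open ≈-Reasoning
    columns : ∀ j → ∑ (λ i → pairFamily (f i) (g i) j) ≈ pairFamily (∑ f) (∑ g) j
    columns zero          = refl
    columns (suc zero)    = refl
    columns (suc (suc j)) = ∑-0h

  record CountablyAdditive {A B A′ B′} (φ : Hom A B → Hom A′ B′) : Set (ℓ ⊔ e) where
    field
      cong   : ∀ {f g} → f ≈ g → φ f ≈ φ g
      0h-homo : φ 0h ≈ 0h
      +-homo : ∀ {f g} → φ (f + g) ≈ φ f + φ g
      ∑-homo : ∀ fs → φ (∑ fs) ≈ ∑ (λ i → φ (fs i))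

  open CountablyAdditive public

  CountablyAdditive-∘ : ∀ {A B A′ B′ A″ B″} {φ : Hom A′ B′ → Hom A″ B″} {χ : Hom A B → Hom A′ B′} →
                        CountablyAdditive φ → CountablyAdditive χ →
                        CountablyAdditive (λ f → φ (χ f))
  CountablyAdditive-∘ φ χ = record
    { cong    = λ p → cong φ (cong χ p)
    ; 0h-homo = trans (cong φ (0h-homo χ)) (0h-homo φ)
    ; +-homo  = trans (cong φ (+-homo χ)) (+-homo φ)
    ; ∑-homo  = λ fs → trans (cong φ (∑-homo χ fs)) (∑-homo φ _)
    }

  CountablyAdditive-resp : ∀ {A B A′ B′} {φ χ : Hom A B → Hom A′ B′} →
                           (∀ f → φ f ≈ χ f) → CountablyAdditive φ → CountablyAdditive χ
  CountablyAdditive-resp φ≈χ φ = record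
    { cong    = λ p → trans (sym (φ≈χ _)) (trans (cong φ p) (φ≈χ _))
    ; 0h-homo = trans (sym (φ≈χ _)) (0h-homo φ)
    ; +-homo  = trans (sym (φ≈χ _)) (trans (+-homo φ) (+-resp-≈ (φ≈χ _) (φ≈χ _)))
    ; ∑-homo  = λ fs → trans (sym (φ≈χ _)) (trans (∑-homo φ fs) (∑-cong (λ i → φ≈χ _)))
    }

  CountablyAdditive-inverse : ∀ {A B A′ B′} {φ : Hom A B → Hom A′ B′}
                              {ψ : Hom A′ B′ → Hom A B} → (∀ {f g} → f ≈ g → ψ f ≈ ψ g) →
                              (∀ f → ψ (φ f) ≈ f) → (∀ g → g ≈ φ (ψ g)) →
                              CountablyAdditive φ → CountablyAdditive ψ
  CountablyAdditive-inverse {φ = φ} {ψ} ψ-cong ψφ≈id id≈φψ φ-additive = record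
    { cong    = ψ-cong
    ; 0h-homo = trans (ψ-cong (sym (0h-homo φ-additive))) (ψφ≈id 0h)
    ; +-homo  = trans (ψ-cong (trans (+-resp-≈ (id≈φψ _) (id≈φψ _))
                                     (sym (+-homo φ-additive))))
                      (ψφ≈id _)
    ; ∑-homo  = λ gs → trans (ψ-cong (trans (∑-cong (λ i → id≈φψ (gs i)))
                                            (sym (∑-homo φ-additive _))))
                             (ψφ≈id _)
    }

  precompose-additive : ∀ {A B X} (g : Hom X A) → CountablyAdditive (λ (f : Hom A B) → f ∘ g)
  precompose-additive g = record
    { cong = ∘-congˡ ; 0h-homo = 0-∘ ; +-homo = +-∘ ; ∑-homo = λ fs → ∑-∘ fs g }

  D-additive : ∀ {A B} → CountablyAdditive (D {A} {B})
  D-additive = record { cong = D-resp-≈ ; 0h-homo = D1-0 ; +-homo = D1-+ ; ∑-homo = D1-∑ }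

  D-additive-in-direction : ∀ {A B C} (f : Hom A B) (v : Hom C A) →
                            CountablyAdditive (λ (h : Hom C A) → D f ∘ ⟨ h , v ⟩)
  D-additive-in-direction f v = record
    { cong    = λ p → ∘-congʳ (⟨⟩-cong p refl)
    ; 0h-homo = D2-0
    ; +-homo  = D2-+
    ; ∑-homo  = λ hs → D2-∑ f hs v
    }

  linear-postcompose-additive : ∀ {A B X} {L : Hom A B} → Linear L →
                                CountablyAdditive (λ (f : Hom X A) → L ∘ f)
  linear-postcompose-additive {L = L} linear =
    CountablyAdditive-resp derivative-at-0h (D-additive-in-direction L 0h)
    where
    derivative-at-0h : ∀ f → D L ∘ ⟨ f , 0h ⟩ ≈ L ∘ f
    derivative-at-0h f = trans (∘-congˡ linear) (trans assoc (∘-congʳ project₁))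

  ⟨0h,-⟩-additive : ∀ {A B X} → CountablyAdditive (λ (g : Hom X B) → ⟨ 0h {X} {A} , g ⟩)
  ⟨0h,-⟩-additive = record
    { cong    = ⟨⟩-cong refl
    ; 0h-homo = ⟨⟩-unique (proj₂ π₁-additive) (proj₂ π₂-additive)
    ; +-homo  = ⟨⟩-unique
        (trans (proj₁ π₁-additive _ _) (trans (+-resp-≈ project₁ project₁) +-identityˡ))
        (trans (proj₁ π₂-additive _ _) (+-resp-≈ project₂ project₂))
    ; ∑-homo  = λ gs → ⟨⟩-unique
        (trans (π₁-∑ _) (trans (∑-cong (λ i → project₁)) ∑-0h))
        (trans (π₂-∑ _) (∑-cong (λ i → project₂)))
    }

  Λ-cong : ∀ {A B C} {f g : Hom (C × A) B} → f ≈ g → Λ f ≈ Λ g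
  Λ-cong p = Λ-unique (trans Λ-β p)

  Λ⁻-cong : ∀ {A B C} {f g : Hom C (A ⇒ B)} → f ≈ g → Λ⁻ f ≈ Λ⁻ g
  Λ⁻-cong p = ∘-congʳ (⟨⟩-cong (∘-congˡ p) refl)

  Λ-additive : ∀ {A B C} → CountablyAdditive (Λ {A} {B} {C})
  Λ-additive = record { cong = Λ-cong ; 0h-homo = Λ-0 ; +-homo = Λ-+ ; ∑-homo = Λ-∑ }

  Λ⁻-additive : ∀ {A B C} → CountablyAdditive (Λ⁻ {A} {B} {C})
  Λ⁻-additive = CountablyAdditive-inverse Λ⁻-cong (λ _ → Λ-β) (λ _ → Λ-unique refl) Λ-additive

  ⋆-additiveˡ : ∀ {A B C} (g : Hom C A) → CountablyAdditive (λ (f : Hom (C × A) B) → f ⋆ g)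
  ⋆-additiveˡ g = CountablyAdditive-∘ (precompose-additive _) D-additive

  ⋆-additiveʳ : ∀ {A B C} (f : Hom (C × A) B) → CountablyAdditive (λ (g : Hom C A) → f ⋆ g)
  ⋆-additiveʳ f = CountablyAdditive-∘ (D-additive-in-direction f id)
                    (CountablyAdditive-∘ ⟨0h,-⟩-additive (precompose-additive π₁))

  Λ⁻-∘-⟨id,-⟩ : ∀ {A B X} {h : Hom X (A ⇒ B)} {c : Hom X A} →
                Λ⁻ h ∘ ⟨ id , c ⟩ ≈ ev ∘ ⟨ h , c ⟩
  Λ⁻-∘-⟨id,-⟩ = trans assoc (∘-congʳ (trans ⟨⟩-∘ (⟨⟩-cong
    (trans assoc (trans (∘-congʳ project₁) identityʳ))
    (trans assoc (trans (∘-congʳ project₂) identityˡ)))))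

module ReflexiveSemantics {o ℓ e} (M : TaylorModel o ℓ e)
                          (R : LinearReflexive (TaylorModel.ccdc M)) where
  open TaylorModel M
  open CountableSums M
  open LinearReflexive R renaming (lam to lamᵁ)

  lamᵁ∘Λ-additive : ∀ {Γ} → CountablyAdditive (λ (f : Hom (Γ × U) U) → lamᵁ ∘ Λ f)
  lamᵁ∘Λ-additive = CountablyAdditive-∘ (linear-postcompose-additive lam-linear) Λ-additive

  -- ⟦ D· s t ⟧ˢ and ⟦ app s [] ⟧ˢ unfold definitionally to D·ᵁ ⟦ s ⟧ˢ ⟦ t ⟧ˢ and app0ᵁ ⟦ s ⟧ˢ.
  D·ᵁ : ∀ {Γ} → Hom Γ U → Hom Γ U → Hom Γ U
  D·ᵁ a b = lamᵁ ∘ Λ (Λ⁻ (𝒜 ∘ a) ⋆ b)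

  D·ᵁ-additiveˡ : ∀ {Γ} (b : Hom Γ U) → CountablyAdditive (λ a → D·ᵁ a b)
  D·ᵁ-additiveˡ b =
    CountablyAdditive-∘ lamᵁ∘Λ-additive
      (CountablyAdditive-∘ (⋆-additiveˡ b)
        (CountablyAdditive-∘ Λ⁻-additive (linear-postcompose-additive 𝒜-linear)))

  D·ᵁ-additiveʳ : ∀ {Γ} (a : Hom Γ U) → CountablyAdditive (D·ᵁ a)
  D·ᵁ-additiveʳ a = CountablyAdditive-∘ lamᵁ∘Λ-additive (⋆-additiveʳ _)

  D·ᵁ-cong : ∀ {Γ} {a a′ b b′ : Hom Γ U} → a ≈ a′ → b ≈ b′ → D·ᵁ a b ≈ D·ᵁ a′ b′
  D·ᵁ-cong p q = trans (cong (D·ᵁ-additiveˡ _) p) (cong (D·ᵁ-additiveʳ _) q)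

  D·ᵁ^ : ∀ {Γ} → ℕ → Hom Γ U → Hom Γ U → Hom Γ U
  D·ᵁ^ k a b = iter k (λ x → D·ᵁ x b) a

  D·ᵁ^-cong : ∀ {Γ} k {a a′ b b′ : Hom Γ U} → a ≈ a′ → b ≈ b′ → D·ᵁ^ k a b ≈ D·ᵁ^ k a′ b′
  D·ᵁ^-cong zero    p q = p
  D·ᵁ^-cong (suc k) p q = D·ᵁ-cong (D·ᵁ^-cong k p q) q

  app0ᵁ : ∀ {Γ} → Hom Γ U → Hom Γ U
  app0ᵁ a = ev ∘ ⟨ 𝒜 ∘ a , 0h ⟩

  app0ᵁ-additive : ∀ {Γ} → CountablyAdditive (app0ᵁ {Γ})
  app0ᵁ-additive = CountablyAdditive-resp (λ _ → Λ⁻-∘-⟨id,-⟩)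
    (CountablyAdditive-∘ (precompose-additive _)
      (CountablyAdditive-∘ Λ⁻-additive (linear-postcompose-additive 𝒜-linear)))

  Λ⁻𝒜-D·ᵁ : ∀ {Γ} (a b : Hom Γ U) → Λ⁻ (𝒜 ∘ D·ᵁ a b) ≈ Λ⁻ (𝒜 ∘ a) ⋆ b
  Λ⁻𝒜-D·ᵁ a b = trans (Λ⁻-cong (trans (sym assoc) (trans (∘-congˡ retract) identityˡ))) Λ-β

  Λ⁻𝒜-D·ᵁ^ : ∀ {Γ} k (a b : Hom Γ U) →
             Λ⁻ (𝒜 ∘ D·ᵁ^ k a b) ≈ iter k (_⋆ b) (Λ⁻ (𝒜 ∘ a))
  Λ⁻𝒜-D·ᵁ^ zero    a b = refl
  Λ⁻𝒜-D·ᵁ^ (suc k) a b = trans (Λ⁻𝒜-D·ᵁ _ b) (cong (⋆-additiveˡ b) (Λ⁻𝒜-D·ᵁ^ k a b))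

  taylor-reflexive : ∀ {Γ} (a b : Hom Γ U) →
                     ev ∘ ⟨ 𝒜 ∘ a , b ⟩ ≈ ∑ (λ k → app0ᵁ (D·ᵁ^ k a b))
  taylor-reflexive a b = begin
    ev ∘ ⟨ 𝒜 ∘ a , b ⟩                                   ≈⟨ taylor _ _ ⟩
    ∑ (λ k → iter k (_⋆ b) (Λ⁻ (𝒜 ∘ a)) ∘ ⟨ id , 0h ⟩)  ≈⟨ ∑-cong (λ k → ∘-congˡ (Λ⁻𝒜-D·ᵁ^ k a b)) ⟨
    ∑ (λ k → Λ⁻ (𝒜 ∘ D·ᵁ^ k a b) ∘ ⟨ id , 0h ⟩)         ≈⟨ ∑-cong (λ k → Λ⁻-∘-⟨id,-⟩) ⟩
    ∑ (λ k → app0ᵁ (D·ᵁ^ k a b))                         ∎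
    where open ≈-Reasoning

module TaylorSoundness {o ℓ e} (M : TaylorModel o ℓ e)
                       (R : LinearReflexive (TaylorModel.ccdc M)) where
  open TaylorModel M
  open CountableSums M
  open LinearReflexive R using (𝒜)
  open ReflexiveSemantics M R
  open Interpretation M R

  ⟦++⟧ : ∀ {n} (S T : Term n) → ⟦ S ++ T ⟧ ≈ ⟦ S ⟧ + ⟦ T ⟧
  ⟦++⟧ []      T = sym +-identityˡ
  ⟦++⟧ (s ∷ S) T = trans (+-resp-≈ refl (⟦++⟧ S T)) (sym +-assoc)

  ⟦map⟧ : ∀ {m n} (h : Simple m → Simple n) {φ : Hom (U^ m) _ → Hom (U^ n) _} →
          CountablyAdditive φ → (∀ s → ⟦ h s ⟧ˢ ≈ φ ⟦ s ⟧ˢ) →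
          ∀ T → ⟦ map h T ⟧ ≈ φ ⟦ T ⟧
  ⟦map⟧ h φ ⟦h⟧ []      = sym (0h-homo φ)
  ⟦map⟧ h φ ⟦h⟧ (s ∷ T) = trans (+-resp-≈ (⟦h⟧ s) (⟦map⟧ h φ ⟦h⟧ T)) (sym (+-homo φ))

  ⟦mapFam⟧∞ : ∀ {m n} (h : Simple m → Simple n) {φ : Hom (U^ m) _ → Hom (U^ n) _} →
              CountablyAdditive φ → (∀ s → ⟦ h s ⟧ˢ ≈ φ ⟦ s ⟧ˢ) →
              ∀ F → ⟦ mapFam h F ⟧∞ ≈ φ ⟦ F ⟧∞
  ⟦mapFam⟧∞ h φ ⟦h⟧ F = trans (∑-cong (λ i → ⟦map⟧ h φ ⟦h⟧ (F i))) (sym (∑-homo φ _))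

  ⟦plusFam⟧∞ : ∀ {n} (F G : Fam n) → ⟦ plusFam F G ⟧∞ ≈ ⟦ F ⟧∞ + ⟦ G ⟧∞
  ⟦plusFam⟧∞ F G = trans (∑-cong (λ i → ⟦++⟧ (F i) (G i))) (∑-+ _ _)

  ⟦single⟧∞ : ∀ {n} (s : Simple n) → ⟦ single s ⟧∞ ≈ ⟦ s ⟧ˢ
  ⟦single⟧∞ s = trans (∑-finite _ 1 vanishes) (trans +-identityˡ +-identityʳ′)
    where
    vanishes : ∀ m → 1 ≤ m → ⟦ single s m ⟧ ≈ 0h
    vanishes (suc m) _ = refl

  ⟦bigSum⟧∞ : ∀ {n} (F : ℕ → Fam n) → ⟦ bigSum F ⟧∞ ≈ ∑ (λ k → ⟦ F k ⟧∞)
  ⟦bigSum⟧∞ F = sym (∑-flatten (λ i j → ⟦ F i j ⟧))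

  ⟦concatMap-D·⟧ : ∀ {n} (S T : Term n) →
                   ⟦ concatMap (λ s → map (D· s) T) S ⟧ ≈ D·ᵁ ⟦ S ⟧ ⟦ T ⟧
  ⟦concatMap-D·⟧ []      T = sym (0h-homo (D·ᵁ-additiveˡ _))
  ⟦concatMap-D·⟧ (s ∷ S) T = begin
    ⟦ map (D· s) T ++ concatMap (λ s → map (D· s) T) S ⟧
      ≈⟨ ⟦++⟧ (map (D· s) T) _ ⟩
    ⟦ map (D· s) T ⟧ + ⟦ concatMap (λ s → map (D· s) T) S ⟧
      ≈⟨ +-resp-≈ (⟦map⟧ (D· s) (D·ᵁ-additiveʳ ⟦ s ⟧ˢ) (λ _ → refl) T) (⟦concatMap-D·⟧ S T) ⟩
    D·ᵁ ⟦ s ⟧ˢ ⟦ T ⟧ + D·ᵁ ⟦ S ⟧ ⟦ T ⟧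
      ≈⟨ +-homo (D·ᵁ-additiveˡ _) ⟨
    D·ᵁ ⟦ s ∷ S ⟧ ⟦ T ⟧ ∎
    where open ≈-Reasoning

  ⟦combine-D·⟧∞ : ∀ {n} (F G : Fam n) → ⟦ combine D· F G ⟧∞ ≈ D·ᵁ ⟦ F ⟧∞ ⟦ G ⟧∞
  ⟦combine-D·⟧∞ F G = begin
    ∑ (λ k → ⟦ combine D· F G k ⟧)
      ≈⟨ ∑-cong (λ k → ⟦concatMap-D·⟧ (F (proj₁ (unpair k))) (G (proj₂ (unpair k)))) ⟩
    ∑ (λ k → D·ᵁ ⟦ F (proj₁ (unpair k)) ⟧ ⟦ G (proj₂ (unpair k)) ⟧)
      ≈⟨ ∑-flatten (λ i j → D·ᵁ ⟦ F i ⟧ ⟦ G j ⟧) ⟨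
    ∑ (λ i → ∑ (λ j → D·ᵁ ⟦ F i ⟧ ⟦ G j ⟧))
      ≈⟨ ∑-cong (λ i → ∑-homo (D·ᵁ-additiveʳ _) _) ⟨
    ∑ (λ i → D·ᵁ ⟦ F i ⟧ ⟦ G ⟧∞)
      ≈⟨ ∑-homo (D·ᵁ-additiveˡ _) _ ⟨
    D·ᵁ ⟦ F ⟧∞ ⟦ G ⟧∞ ∎
    where open ≈-Reasoning

  ⟦Dpow⟧∞ : ∀ {n} k (F G : Fam n) → ⟦ Dpow k F G ⟧∞ ≈ D·ᵁ^ k ⟦ F ⟧∞ ⟦ G ⟧∞
  ⟦Dpow⟧∞ zero    F G = refl
  ⟦Dpow⟧∞ (suc k) F G = trans (⟦combine-D·⟧∞ (Dpow k F G) G) (D·ᵁ-cong (⟦Dpow⟧∞ k F G) refl)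

  mutual
    ⟦⟧ˢ-taylor : ∀ {n} (s : Simple n) → ⟦ s ⟧ˢ ≈ ⟦ s *ˢ ⟧∞
    ⟦⟧ˢ-taylor (var x)  = sym (⟦single⟧∞ (var x))
    ⟦⟧ˢ-taylor (lam s)  = trans (cong lamᵁ∘Λ-additive (⟦⟧ˢ-taylor s))
                                (sym (⟦mapFam⟧∞ lam lamᵁ∘Λ-additive (λ _ → refl) (s *ˢ)))
    ⟦⟧ˢ-taylor (D· s t) = trans (D·ᵁ-cong (⟦⟧ˢ-taylor s) (⟦⟧ˢ-taylor t))
                                (sym (⟦combine-D·⟧∞ (s *ˢ) (t *ˢ)))
    ⟦⟧ˢ-taylor (app s T) = begin
      ev ∘ ⟨ 𝒜 ∘ ⟦ s ⟧ˢ , ⟦ T ⟧ ⟩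
        ≈⟨ taylor-reflexive ⟦ s ⟧ˢ ⟦ T ⟧ ⟩
      ∑ (λ k → app0ᵁ (D·ᵁ^ k ⟦ s ⟧ˢ ⟦ T ⟧))
        ≈⟨ ∑-cong (λ k → cong app0ᵁ-additive (D·ᵁ^-cong k (⟦⟧ˢ-taylor s) (⟦⟧-taylor T))) ⟩
      ∑ (λ k → app0ᵁ (D·ᵁ^ k ⟦ s *ˢ ⟧∞ ⟦ T * ⟧∞))
        ≈⟨ ∑-cong (λ k → cong app0ᵁ-additive (⟦Dpow⟧∞ k (s *ˢ) (T *))) ⟨
      ∑ (λ k → app0ᵁ ⟦ Dᵏs·T k ⟧∞)
        ≈⟨ ∑-cong (λ k → ⟦mapFam⟧∞ (λ u → app u []) app0ᵁ-additive (λ _ → refl) (Dᵏs·T k)) ⟨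
      ∑ (λ k → ⟦ mapFam (λ u → app u []) (Dᵏs·T k) ⟧∞)
        ≈⟨ ⟦bigSum⟧∞ (λ k → mapFam (λ u → app u []) (Dᵏs·T k)) ⟨
      ⟦ app s T *ˢ ⟧∞ ∎
      where
      open ≈-Reasoning
      Dᵏs·T : ℕ → Fam _
      Dᵏs·T k = Dpow k (s *ˢ) (T *)

    ⟦⟧-taylor : ∀ {n} (S : Term n) → ⟦ S ⟧ ≈ ⟦ S * ⟧∞
    ⟦⟧-taylor []      = sym ∑-0h
    ⟦⟧-taylor (s ∷ S) = trans (+-resp-≈ (⟦⟧ˢ-taylor s) (⟦⟧-taylor S))
                              (sym (⟦plusFam⟧∞ (s *ˢ) (S *)))

theorem4p14 : ∀ {o ℓ e} (M : TaylorModel o ℓ e)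
                (R : LinearReflexive (TaylorModel.ccdc M)) (n : ℕ) (S : Term n) →
                TaylorModel._≈_ M (Interpretation.⟦_⟧ M R S) (Interpretation.⟦_⟧∞ M R (S *))
theorem4p14 M R n S = TaylorSoundness.⟦⟧-taylor M R S
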